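{- If $G$ and $H$ are connected graphs, then $\mathrm{gp}_{\rm t}(G\boxtimes H)=s(G)\,s(H)$.
   Context: All graphs are finite and simple. For $X\subseteq V(G)$, two vertices $u,v$ are $X$-positionable if no shortest $u,v$-path has an internal vertex in $X$. $X$ is a total general position set if every two vertices of $V(G)$ are $X$-positionable; $\mathrm{gp}_{\rm t}(G)$ is the maximum cardinality of such a set. A vertex is simplicial if its neighbourhood induces a complete subgraph; $s(G)$ is the number of simplicial vertices of $G$. The strong product $G\boxtimes H$ has vertex set $V(G)\times V(H)$, with $(g,h)$ and $(g',h')$ adjacent iff either $g=g'$ and $hh'\in E(H)$, or $gg'\in E(G)$ and $h=h'$, or $gg'\in E(G)$ and $hh'\in E(H)$. -}

module Defs where

open import Data.Nat using (ℕ; zero; suc; _*_; _≤_)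
open import Data.Bool using (Bool; true; false; _∧_; _∨_; T)
open import Data.Fin using (Fin; remQuot; _≟_)
open import Data.Fin.Subset using (Subset; _∈_; ∣_∣)
open import Data.Product using (Σ; _×_; _,_; proj₁; proj₂; ∃)
open import Relation.Nullary using (¬_; does)
open import Relation.Binary.PropositionalEquality using (_≡_; _≢_)
open import Function.Bundles using (_⇔_)

record Graph : Set where
  constructor mkGraph
  field
    n     : ℕ
    adj   : Fin n → Fin n → Bool

open Graph public

IsSimple : Graph → Set
IsSimple G = (∀ u → adj G u u ≡ false) × (∀ u v → adj G u v ≡ adj G v u)

V : Graph → Set
V G = Fin (n G)

Adj : (G : Graph) → V G → V G → Set
Adj G u v = T (adj G u v)

data Walk (G : Graph) : V G → V G → ℕ → Set where
  here : ∀ {u} → Walk G u u zero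
  step : ∀ {u w v k} → Adj G u w → Walk G w v k → Walk G u v (suc k)

-- x is an internal vertex of the walk (neither the first nor the last vertex
-- position).
data Internal (G : Graph) : ∀ {u v k} → V G → Walk G u v k → Set where
  first : ∀ {u w v k} {a : Adj G u w} {p : Walk G w v (suc k)} →
          Internal G w (step a p)
  later : ∀ {u w v k x} {a : Adj G u w} {p : Walk G w v k} →
          Internal G x p → Internal G x (step a p)

-- A shortest u,v-walk (necessarily a shortest path): no u,v-walk is shorter.
IsShortest : (G : Graph) → ∀ {u v k} → Walk G u v k → Set
IsShortest G {u} {v} {k} p = ∀ m → Walk G u v m → k ≤ m

Connected : Graph → Set
Connected G = ∀ u v → ∃ λ k → Walk G u v k

Positionable : (G : Graph) → Subset (n G) → V G → V G → Set
Positionable G X u v =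
  ∀ k (p : Walk G u v k) → IsShortest G p → ∀ x → Internal G x p → ¬ (x ∈ X)

IsTotalGP : (G : Graph) → Subset (n G) → Set
IsTotalGP G X = ∀ u v → Positionable G X u v

GpT≡ : Graph → ℕ → Set
GpT≡ G m =
  (Σ (Subset (n G)) λ X → IsTotalGP G X × ∣ X ∣ ≡ m) ×
  (∀ X → IsTotalGP G X → ∣ X ∣ ≤ m)

Simplicial : (G : Graph) → V G → Set
Simplicial G v = ∀ a b → Adj G v a → Adj G v b → a ≢ b → Adj G a b

-- S is exactly the set of simplicial vertices of G (so s(G) = ∣ S ∣).
IsSimplicialSet : (G : Graph) → Subset (n G) → Set
IsSimplicialSet G S = ∀ v → (v ∈ S) ⇔ Simplicial G v

-- Strong product; vertex (g,h) is encoded as Fin (n G * n H) via remQuot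
-- (the inverse of Data.Fin.combine).
strongAdj : (G H : Graph) → Fin (n G * n H) → Fin (n G * n H) → Bool
strongAdj G H x y with remQuot {n G} (n H) x | remQuot {n G} (n H) y
... | g , h | g' , h' =
  (does (g ≟ g') ∧ adj H h h') ∨
  (adj G g g' ∧ does (h ≟ h')) ∨
  (adj G g g' ∧ adj H h h')

_⊠_ : Graph → Graph → Graph
G ⊠ H = mkGraph (n G * n H) (strongAdj G H)

-- A vertex of a total general position set X is simplicial: if it had two
-- non-adjacent neighbours a, b, then a x b would be a shortest a,b-path with
-- internal vertex x ∈ X. Conversely a simplicial vertex is never internal to a
-- shortest path, since its two path-neighbours are equal or adjacent and the
-- path could be shortened. Hence gp_t(K) = s(K) for every graph K, connected
-- or not. In the strong product the closed neighbourhood of (g,h) is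
-- N[g] × N[h], which is a clique exactly when N[g] and N[h] are; so the
-- simplicial vertices of G ⊠ H are the pairs of simplicial vertices.
module Submission where

open import Defs
open import Data.Nat using (zero; suc; _+_; _*_; z≤n; s≤s)
open import Data.Nat.Properties using (≤-pred; 1+n≰n; ≤-trans; n≤1+n)
open import Data.Bool using (Bool; true; false; _∧_; _∨_; T; T?)
open import Data.Bool.Properties using (T-∧; T-∨)
open import Data.Fin using (Fin; remQuot; combine; _≟_)
open import Data.Fin.Properties using (remQuot-combine; combine-remQuot)
open import Data.Fin.Subset using (Subset; _∈_; ∣_∣)
open import Data.Fin.Subset.Properties using (p⊆q⇒∣p∣≤∣q∣; ∣⊥∣≡0)
open import Data.Vec using ([]; _∷_; _++_; map; lookup; _⊛*_)
open import Data.Vec.Properties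
  using (map-id; map-const; lookup-map; lookup-⊛*; []=⇒lookup; lookup⇒[]=)
open import Data.Product using (_×_; _,_; proj₁; proj₂; uncurry)
open import Data.Product.Function.NonDependent.Propositional using (_×-⇔_)
open import Data.Sum using (_⊎_; inj₁; inj₂)
open import Data.Empty using (⊥-elim)
open import Relation.Nullary using (¬_; Dec; yes; no; does)
open import Relation.Binary.PropositionalEquality
  using (_≡_; _≢_; refl; sym; trans; cong; cong₂; subst; subst₂)
open import Function using (_∘_; const)
open import Function.Bundles using (_⇔_; mk⇔; Equivalence)
open import Function.Properties.Equivalence using ()
  renaming (refl to ⇔-refl; sym to ⇔-sym; trans to ⇔-trans)

open Equivalence using (to; from)

SymmetricAdj : Graph → Set
SymmetricAdj G = ∀ {u v} → Adj G u v → Adj G v u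

IsSimple⇒SymmetricAdj : ∀ G → IsSimple G → SymmetricAdj G
IsSimple⇒SymmetricAdj G (_ , adj-sym) {u} {v} = subst T (adj-sym u v)

IsShortest-tail : ∀ G {u w v k} (a : Adj G u w) (p : Walk G w v k) →
                  IsShortest G (step a p) → IsShortest G p
IsShortest-tail G a p shortest m q = ≤-pred (shortest (suc m) (step a q))

module _ (G : Graph) (adj-sym : SymmetricAdj G) where

  simplicial-not-internal : ∀ {u v k} (p : Walk G u v k) → IsShortest G p →
                            ∀ {x} → Internal G x p → ¬ Simplicial G x
  simplicial-not-internal (step {u = u} a (step {w = w} b p)) shortest first simplicial
    with u ≟ w
  ... | yes refl = 1+n≰n (≤-trans (n≤1+n _) (shortest _ p))
  ... | no u≢w   = 1+n≰n (shortest _ (step (simplicial u w (adj-sym a) b u≢w) p))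
  simplicial-not-internal (step a p) shortest (later i) =
    simplicial-not-internal p (IsShortest-tail G a p shortest) i

  simplicial⇒totalGP : ∀ X → (∀ x → x ∈ X → Simplicial G x) → IsTotalGP G X
  simplicial⇒totalGP X simplicial u v k p shortest x i x∈X =
    simplicial-not-internal p shortest i (simplicial x x∈X)

  totalGP⇒simplicial : ∀ X → IsTotalGP G X → ∀ x → x ∈ X → Simplicial G x
  totalGP⇒simplicial X totalGP x x∈X a b xa xb a≢b with T? (adj G a b)
  ... | yes ab = ab
  ... | no ¬ab = ⊥-elim (totalGP a b 2 path shortest x first x∈X)
    where
      path : Walk G a b 2
      path = step (adj-sym xa) (step xb here)

      shortest : IsShortest G path
      shortest zero          here           = ⊥-elim (a≢b refl)
      shortest (suc zero)    (step ab here) = ⊥-elim (¬ab ab)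
      shortest (suc (suc m)) _              = s≤s (s≤s z≤n)

  gpT≡simplicialCount : ∀ S → IsSimplicialSet G S → GpT≡ G ∣ S ∣
  gpT≡simplicialCount S isS =
    (S , simplicial⇒totalGP S (λ x → to (isS x)) , refl) ,
    λ X totalGP → p⊆q⇒∣p∣≤∣q∣ λ {x} x∈X →
      from (isS x) (totalGP⇒simplicial X totalGP x x∈X)

_⊗_ : ∀ {m k} → Subset m → Subset k → Subset (m * k)
p ⊗ q = map _∧_ p ⊛* q

∣p++q∣≡∣p∣+∣q∣ : ∀ {m k} (p : Subset m) (q : Subset k) → ∣ p ++ q ∣ ≡ ∣ p ∣ + ∣ q ∣
∣p++q∣≡∣p∣+∣q∣ []          q = refl
∣p++q∣≡∣p∣+∣q∣ (true ∷ p)  q = cong suc (∣p++q∣≡∣p∣+∣q∣ p q)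
∣p++q∣≡∣p∣+∣q∣ (false ∷ p) q = ∣p++q∣≡∣p∣+∣q∣ p q

∣p⊗q∣≡∣p∣*∣q∣ : ∀ {m k} (p : Subset m) (q : Subset k) → ∣ p ⊗ q ∣ ≡ ∣ p ∣ * ∣ q ∣
∣p⊗q∣≡∣p∣*∣q∣ [] q = refl
∣p⊗q∣≡∣p∣*∣q∣ (true ∷ p) q = trans (∣p++q∣≡∣p∣+∣q∣ (map (true ∧_) q) (p ⊗ q))
  (cong₂ _+_ (cong ∣_∣ (map-id q)) (∣p⊗q∣≡∣p∣*∣q∣ p q))
∣p⊗q∣≡∣p∣*∣q∣ {k = k} (false ∷ p) q = trans (∣p++q∣≡∣p∣+∣q∣ (map (false ∧_) q) (p ⊗ q))
  (cong₂ _+_ (trans (cong ∣_∣ (map-const q false)) (∣⊥∣≡0 k)) (∣p⊗q∣≡∣p∣*∣q∣ p q))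

lookup-⊗ : ∀ {m k} (p : Subset m) (q : Subset k) i j →
           lookup (p ⊗ q) (combine i j) ≡ lookup p i ∧ lookup q j
lookup-⊗ p q i j = trans (lookup-⊛* (map _∧_ p) q i j)
                         (cong (λ f → f (lookup q j)) (lookup-map i _∧_ p))

∈⇔lookup≡true : ∀ {m} {x : Fin m} {p : Subset m} → x ∈ p ⇔ lookup p x ≡ true
∈⇔lookup≡true {x = x} {p} = mk⇔ []=⇒lookup (lookup⇒[]= x p)

∧≡true⇔ : ∀ {a b} → a ∧ b ≡ true ⇔ (a ≡ true × b ≡ true)
∧≡true⇔ {true}  {true}  = mk⇔ (const (refl , refl)) (const refl)
∧≡true⇔ {true}  {false} = mk⇔ (λ ()) proj₂
∧≡true⇔ {false}         = mk⇔ (λ ()) proj₁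

∈⊗⇔ : ∀ {m k} (p : Subset m) (q : Subset k) x →
      x ∈ p ⊗ q ⇔ (proj₁ (remQuot {m} k x) ∈ p × proj₂ (remQuot {m} k x) ∈ q)
∈⊗⇔ {m} {k} p q x =
  ⇔-trans ∈⇔lookup≡true (⇔-trans lookup≡true⇔ (⇔-trans ∧≡true⇔
    (⇔-sym ∈⇔lookup≡true ×-⇔ ⇔-sym ∈⇔lookup≡true)))
  where
    i : Fin m
    i = proj₁ (remQuot {m} k x)

    j : Fin k
    j = proj₂ (remQuot {m} k x)

    lookup-x : lookup (p ⊗ q) x ≡ lookup p i ∧ lookup q j
    lookup-x = trans (cong (lookup (p ⊗ q)) (sym (combine-remQuot {m} k x))) (lookup-⊗ p q i j)

    lookup≡true⇔ : lookup (p ⊗ q) x ≡ true ⇔ (lookup p i ∧ lookup q j ≡ true)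
    lookup≡true⇔ rewrite lookup-x = ⇔-refl

T-does : ∀ {p} {P : Set p} (P? : Dec P) → T (does P?) ⇔ P
T-does (yes p) = mk⇔ (const p) (const _)
T-does (no ¬p) = mk⇔ (λ ()) ¬p

EqOrAdj : ∀ K → V K → V K → Set
EqOrAdj K u v = u ≡ v ⊎ Adj K u v

simplicial-eqOrAdj : ∀ K → SymmetricAdj K → ∀ {g a b} → Simplicial K g →
                     EqOrAdj K g a → EqOrAdj K g b → EqOrAdj K a b
simplicial-eqOrAdj K adj-sym _ (inj₁ refl) gb          = gb
simplicial-eqOrAdj K adj-sym _ (inj₂ ga)   (inj₁ refl) = inj₂ (adj-sym ga)
simplicial-eqOrAdj K adj-sym {a = a} {b} simplicial (inj₂ ga) (inj₂ gb) with a ≟ b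
... | yes a≡b = inj₁ a≡b
... | no a≢b  = inj₂ (simplicial a b ga gb a≢b)

module StrongProduct (G H : Graph) where

  Pair : Set
  Pair = V G × V H

  pair : V (G ⊠ H) → Pair
  pair = remQuot {n G} (n H)

  pair-injective : ∀ {x y} → pair x ≡ pair y → x ≡ y
  pair-injective {x} {y} eq = trans (sym (combine-remQuot {n G} (n H) x))
    (trans (cong (uncurry combine) eq) (combine-remQuot {n G} (n H) y))

  data StrongAdj : Pair → Pair → Set where
    vertical   : ∀ {g h h'} → Adj H h h' → StrongAdj (g , h) (g , h')
    horizontal : ∀ {g g' h} → Adj G g g' → StrongAdj (g , h) (g' , h)
    diagonal   : ∀ {g g' h h'} → Adj G g g' → Adj H h h' → StrongAdj (g , h) (g' , h')

  StrongAdjᵇ : Pair → Pair → Bool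
  StrongAdjᵇ (g , h) (g' , h') =
    (does (g ≟ g') ∧ adj H h h') ∨ (adj G g g' ∧ does (h ≟ h')) ∨ (adj G g g' ∧ adj H h h')

  T-StrongAdjᵇ : ∀ p q → T (StrongAdjᵇ p q) ⇔ StrongAdj p q
  T-StrongAdjᵇ (g , h) (g' , h') = mk⇔ decode encode
    where
      g≡g' h≡h' gg' hh' : Bool
      g≡g' = does (g ≟ g')
      h≡h' = does (h ≟ h')
      gg'  = adj G g g'
      hh'  = adj H h h'

      decode : T (StrongAdjᵇ (g , h) (g' , h')) → StrongAdj (g , h) (g' , h')
      decode t with to (T-∨ {g≡g' ∧ hh'}) t
      ... | inj₁ t₁ with to (T-∧ {g≡g'}) t₁
      ...   | e , a with refl ← to (T-does (g ≟ g')) e = vertical a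
      decode t | inj₂ t₂ with to (T-∨ {gg' ∧ h≡h'}) t₂
      ... | inj₁ t₃ with to (T-∧ {gg'}) t₃
      ...   | a , e with refl ← to (T-does (h ≟ h')) e = horizontal a
      decode t | inj₂ t₂ | inj₂ t₄ = uncurry diagonal (to (T-∧ {gg'}) t₄)

      encode : StrongAdj (g , h) (g' , h') → T (StrongAdjᵇ (g , h) (g' , h'))
      encode (vertical a) = from (T-∨ {g≡g' ∧ hh'})
        (inj₁ (from (T-∧ {g≡g'}) (from (T-does (g ≟ g')) refl , a)))
      encode (horizontal a) = from (T-∨ {g≡g' ∧ hh'}) (inj₂ (from (T-∨ {gg' ∧ h≡h'})
        (inj₁ (from (T-∧ {gg'}) (a , from (T-does (h ≟ h')) refl)))))
      encode (diagonal a b) = from (T-∨ {g≡g' ∧ hh'}) (inj₂ (from (T-∨ {gg' ∧ h≡h'})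
        (inj₂ (from (T-∧ {gg'}) (a , b)))))

  -- strongAdj matches on the record remQuot x, so it unfolds to StrongAdjᵇ by eta.
  Adj⊠⇔StrongAdj : ∀ x y → Adj (G ⊠ H) x y ⇔ StrongAdj (pair x) (pair y)
  Adj⊠⇔StrongAdj x y = T-StrongAdjᵇ (pair x) (pair y)

  vertex : Pair → V (G ⊠ H)
  vertex = uncurry combine

  pair-vertex : ∀ p → pair (vertex p) ≡ p
  pair-vertex (g , h) = remQuot-combine g h

  StrongAdj⇒EqOrAdj₁ : ∀ {p q} → StrongAdj p q → EqOrAdj G (proj₁ p) (proj₁ q)
  StrongAdj⇒EqOrAdj₁ (vertical _)   = inj₁ refl
  StrongAdj⇒EqOrAdj₁ (horizontal a) = inj₂ a
  StrongAdj⇒EqOrAdj₁ (diagonal a _) = inj₂ a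

  StrongAdj⇒EqOrAdj₂ : ∀ {p q} → StrongAdj p q → EqOrAdj H (proj₂ p) (proj₂ q)
  StrongAdj⇒EqOrAdj₂ (vertical a)   = inj₂ a
  StrongAdj⇒EqOrAdj₂ (horizontal _) = inj₁ refl
  StrongAdj⇒EqOrAdj₂ (diagonal _ b) = inj₂ b

  EqOrAdj⇒StrongAdj : ∀ {p q} → EqOrAdj G (proj₁ p) (proj₁ q) →
                      EqOrAdj H (proj₂ p) (proj₂ q) → p ≢ q → StrongAdj p q
  EqOrAdj⇒StrongAdj (inj₁ refl) (inj₁ refl) p≢q = ⊥-elim (p≢q refl)
  EqOrAdj⇒StrongAdj (inj₁ refl) (inj₂ b)    _   = vertical b
  EqOrAdj⇒StrongAdj (inj₂ a)    (inj₁ refl) _   = horizontal a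
  EqOrAdj⇒StrongAdj (inj₂ a)    (inj₂ b)    _   = diagonal a b

  SimplicialPair : Pair → Set
  SimplicialPair p = ∀ q r → StrongAdj p q → StrongAdj p r → q ≢ r → StrongAdj q r

  simplicial⊠⇔simplicialPair : ∀ x → Simplicial (G ⊠ H) x ⇔ SimplicialPair (pair x)
  simplicial⊠⇔simplicialPair x = mk⇔ toPair fromPair
    where
      Adj⊠-vertex : ∀ {q} → StrongAdj (pair x) q → Adj (G ⊠ H) x (vertex q)
      Adj⊠-vertex {q} xq = from (Adj⊠⇔StrongAdj x (vertex q))
        (subst (StrongAdj (pair x)) (sym (pair-vertex q)) xq)

      toPair : Simplicial (G ⊠ H) x → SimplicialPair (pair x)
      toPair simplicial q r xq xr q≢r =
        subst₂ StrongAdj (pair-vertex q) (pair-vertex r)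
          (to (Adj⊠⇔StrongAdj (vertex q) (vertex r))
            (simplicial (vertex q) (vertex r) (Adj⊠-vertex xq) (Adj⊠-vertex xr)
              λ eq → q≢r (trans (sym (pair-vertex q)) (trans (cong pair eq) (pair-vertex r)))))

      fromPair : SimplicialPair (pair x) → Simplicial (G ⊠ H) x
      fromPair simplicial a b xa xb a≢b =
        from (Adj⊠⇔StrongAdj a b)
          (simplicial (pair a) (pair b) (to (Adj⊠⇔StrongAdj x a) xa)
            (to (Adj⊠⇔StrongAdj x b) xb) (a≢b ∘ pair-injective))

  module _ (G-sym : SymmetricAdj G) (H-sym : SymmetricAdj H) where

    StrongAdj-sym : ∀ {p q} → StrongAdj p q → StrongAdj q p
    StrongAdj-sym (vertical b)   = vertical (H-sym b)
    StrongAdj-sym (horizontal a) = horizontal (G-sym a)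
    StrongAdj-sym (diagonal a b) = diagonal (G-sym a) (H-sym b)

    ⊠-symmetricAdj : SymmetricAdj (G ⊠ H)
    ⊠-symmetricAdj {x} {y} xy =
      from (Adj⊠⇔StrongAdj y x) (StrongAdj-sym (to (Adj⊠⇔StrongAdj x y) xy))

    simplicialPair⇔simplicial×simplicial : ∀ p →
      SimplicialPair p ⇔ (Simplicial G (proj₁ p) × Simplicial H (proj₂ p))
    simplicialPair⇔simplicial×simplicial (g , h) = mk⇔ factors pairing
      where
        factors : SimplicialPair (g , h) → Simplicial G g × Simplicial H h
        factors simplicial =
          (λ a b ga gb a≢b →
            horizontal⁻¹ a≢b (simplicial _ _ (horizontal ga) (horizontal gb) (a≢b ∘ cong proj₁))) ,
          (λ a b ha hb a≢b →
            vertical⁻¹ a≢b (simplicial _ _ (vertical ha) (vertical hb) (a≢b ∘ cong proj₂)))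
          where
            horizontal⁻¹ : ∀ {a b} → a ≢ b → StrongAdj (a , h) (b , h) → Adj G a b
            horizontal⁻¹ a≢b (vertical _)   = ⊥-elim (a≢b refl)
            horizontal⁻¹ _   (horizontal a) = a
            horizontal⁻¹ _   (diagonal a _) = a

            vertical⁻¹ : ∀ {a b} → a ≢ b → StrongAdj (g , a) (g , b) → Adj H a b
            vertical⁻¹ a≢b (horizontal _) = ⊥-elim (a≢b refl)
            vertical⁻¹ _   (vertical b)   = b
            vertical⁻¹ _   (diagonal _ b) = b

        pairing : Simplicial G g × Simplicial H h → SimplicialPair (g , h)
        pairing (simplicialG , simplicialH) q r pq pr =
          EqOrAdj⇒StrongAdj
            (simplicial-eqOrAdj G G-sym simplicialG (StrongAdj⇒EqOrAdj₁ pq) (StrongAdj⇒EqOrAdj₁ pr))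
            (simplicial-eqOrAdj H H-sym simplicialH (StrongAdj⇒EqOrAdj₂ pq) (StrongAdj⇒EqOrAdj₂ pr))

    IsSimplicialSet-⊗ : ∀ {SG SH} → IsSimplicialSet G SG → IsSimplicialSet H SH →
                        IsSimplicialSet (G ⊠ H) (SG ⊗ SH)
    IsSimplicialSet-⊗ {SG} {SH} isSG isSH x =
      ⇔-trans (∈⊗⇔ SG SH x) (⇔-trans (isSG _ ×-⇔ isSH _) (⇔-sym (⇔-trans
        (simplicial⊠⇔simplicialPair x) (simplicialPair⇔simplicial×simplicial (pair x)))))

corollary4p2 : (G H : Graph) → IsSimple G → IsSimple H →
    Connected G → Connected H →
    (SG : Subset (n G)) → (SH : Subset (n H)) →
    IsSimplicialSet G SG → IsSimplicialSet H SH →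
    GpT≡ (G ⊠ H) (∣ SG ∣ * ∣ SH ∣)
corollary4p2 G H simpleG simpleH _ _ SG SH isSG isSH =
  subst (GpT≡ (G ⊠ H)) (∣p⊗q∣≡∣p∣*∣q∣ SG SH)
    (gpT≡simplicialCount (G ⊠ H) (⊠-symmetricAdj G-sym H-sym) (SG ⊗ SH)
      (IsSimplicialSet-⊗ G-sym H-sym isSG isSH))
  where
    open StrongProduct G H

    G-sym : SymmetricAdj G
    G-sym = IsSimple⇒SymmetricAdj G simpleG

    H-sym : SymmetricAdj H
    H-sym = IsSimple⇒SymmetricAdj H simpleH
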